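{- Let $G$ be a graph and $M_1,M_2,\dots,M_s$ perfect matchings of $G$ such that for each $i<s$, $M_{i+1}$ is obtained from $M_i$ by a matching 2-switch. Then every integer between $f(G,M_1)$ and $f(G,M_s)$ belongs to $\{f(G,M_1),\dots,f(G,M_s)\}$.
   Context: For a perfect matching $M$ of $G$, a forcing set for $M$ is a subset $S\subseteq M$ contained in no other perfect matching of $G$; $f(G,M)$ is the minimum size of a forcing set for $M$. A matching 2-switch: if $e_1=\{u_1,v_1\}$, $e_2=\{u_2,v_2\}\in M$ and $\{u_1,u_2\},\{v_1,v_2\}$ are edges of $G$, replacing $e_1,e_2$ by $\{u_1,u_2\},\{v_1,v_2\}$ yields a new perfect matching, said to be obtained from $M$ by a matching 2-switch. -}

module Defs where

open import Data.Nat using (ℕ; suc; _≤_)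
open import Data.Fin using (Fin; zero; suc; inject₁; fromℕ)
open import Data.Bool using (Bool; true; false; T)
open import Data.List using (List; length)
open import Data.List.Relation.Unary.All using (All)
open import Data.Product using (Σ; _×_; ∃; ∃-syntax)
open import Data.Empty using (⊥)
open import Relation.Nullary using (¬_)
open import Relation.Binary.PropositionalEquality using (_≡_)

record Graph : Set where
  field
    n      : ℕ
    adj    : Fin n → Fin n → Bool
    sym    : ∀ u v → adj u v ≡ adj v u
    irrefl : ∀ v → adj v v ≡ false
open Graph public

Edge : (G : Graph) → Fin (n G) → Fin (n G) → Set
Edge G u v = T (adj G u v)

-- A perfect matching: every vertex v is matched to its partner  mate v ;
-- the matching is the edge set { {v , mate v} : v vertex }.
record PerfectMatching (G : Graph) : Set where
  field
    mate      : Fin (n G) → Fin (n G)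
    involutive : ∀ v → mate (mate v) ≡ v
    isEdge    : ∀ v → Edge G v (mate v)
open PerfectMatching public

SameMatching : {G : Graph} → PerfectMatching G → PerfectMatching G → Set
SameMatching M M' = ∀ v → mate M v ≡ mate M' v

-- A subset S ⊆ M is given by a list of vertices, each vertex v standing for
-- the edge {v , mate M v} of M.  The edge {v , mate M v} lies in M' iff
-- mate M' v ≡ mate M v.
ContainedIn : {G : Graph} → (M : PerfectMatching G) → List (Fin (n G)) → PerfectMatching G → Set
ContainedIn M S M' = All (λ v → mate M' v ≡ mate M v) S

IsForcingSet : {G : Graph} → (M : PerfectMatching G) → List (Fin (n G)) → Set
IsForcingSet {G} M S = ∀ (M' : PerfectMatching G) → ContainedIn M S M' → SameMatching M' M

-- Number of distinct edges of M represented by the list S.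
-- (Counting list length suffices for the minimum: duplicates only increase length,
--  and every edge set S ⊆ M is represented by a duplicate-free list.)
-- f(G,M) = k : k is the minimum size of a forcing set for M.
IsForcingNumber : (G : Graph) → PerfectMatching G → ℕ → Set
IsForcingNumber G M k =
  (Σ (List (Fin (n G))) λ S → IsForcingSet M S × length S ≡ k)
  × (∀ S → IsForcingSet M S → k ≤ length S)

TwoSwitch : {G : Graph} → PerfectMatching G → PerfectMatching G → Set
TwoSwitch {G} M M' =
  ∃[ u₁ ] ∃[ v₁ ] ∃[ u₂ ] ∃[ v₂ ]
    ( mate M u₁ ≡ v₁ × mate M u₂ ≡ v₂
    × ¬ (u₂ ≡ u₁) × ¬ (u₂ ≡ v₁)
    × Edge G u₁ u₂ × Edge G v₁ v₂
    × mate M' u₁ ≡ u₂ × mate M' v₁ ≡ v₂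
    × (∀ w → ¬ (w ≡ u₁) → ¬ (w ≡ v₁) → ¬ (w ≡ u₂) → ¬ (w ≡ v₂) → mate M' w ≡ mate M w))

-- If M' arises from M by switching the edges {u₁,v₁}, {u₂,v₂} of M to {u₁,u₂}, {v₁,v₂},
-- then from a forcing set S of M' one gets the forcing set {u₁v₁, u₂v₂} ∪ (S minus the
-- edges at u₁, v₁, u₂, v₂) of M.  S must contain such an edge, for otherwise M would
-- contain S; so f(G,M) ≤ f(G,M') + 1.  The 2-switch is symmetric, hence consecutive
-- forcing numbers differ by at most one, and a discrete intermediate value argument
-- finishes the proof.
module Submission where

open import Defs
open import Data.Nat using (ℕ; suc; _≤_)
open import Data.Fin using (Fin; zero; inject₁; fromℕ)
open import Data.Product using (_×_; ∃-syntax)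
open import Data.Sum using (_⊎_)
open import Relation.Binary.PropositionalEquality using (_≡_)

open import Level using (0ℓ)
open import Function using (_∘_)
open import Data.Bool using (T)
open import Data.Nat using (zero; _+_; _<_; s≤s⁻¹)
open import Data.Nat.Properties using (≤-antisym; ≤-trans; ≰⇒>; _≤?_; +-monoʳ-<; module ≤-Reasoning)
open import Data.Fin.Properties using (_≟_)
open import Data.Product using (_,_; proj₁; proj₂)
open import Data.Sum using (inj₁; inj₂)
open import Data.List using (List; []; _∷_; _++_; length; filter)
open import Data.List.Properties using (length-++; filter-notAll)
open import Data.List.Relation.Unary.All as All using (All; []; _∷_)
open import Data.List.Relation.Unary.All.Properties using (++⁻; ¬Any⇒All¬)
open import Data.List.Relation.Unary.Any as Any using (Any; here; there; any?)
open import Data.List.Membership.Propositional using (_∈_)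
open import Data.List.Membership.Propositional.Properties using (∈-filter⁺)
open import Data.Empty using (⊥-elim)
open import Relation.Nullary using (¬_; Dec; yes; no)
open import Relation.Unary using (Pred; Decidable; ∁)
open import Relation.Unary.Properties using (∁?)
open import Relation.Binary.PropositionalEquality as ≡ using (refl; trans; cong; subst)

module _ {G : Graph} where

  edge-irrefl : ∀ {u v} → Edge G u v → ¬ u ≡ v
  edge-irrefl {u} e refl = subst T (irrefl G u) e

  mate-inverse : (M : PerfectMatching G) → ∀ {u v} → mate M u ≡ v → mate M v ≡ u
  mate-inverse M {u} refl = involutive M u

  agree-at-mate : (N M : PerfectMatching G) → ∀ {w}
    → mate N w ≡ mate M w → mate N (mate M w) ≡ mate M (mate M w)
  agree-at-mate N M {w} eq =
    trans (cong (mate N) (≡.sym eq)) (trans (involutive N w) (≡.sym (involutive M w)))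

  Closed : PerfectMatching G → Pred (Fin (n G)) 0ℓ → Set
  Closed M X = ∀ {w} → X w → X (mate M w)

  AgreeOn : Pred (Fin (n G)) 0ℓ → PerfectMatching G → PerfectMatching G → Set
  AgreeOn X M N = ∀ {w} → X w → mate M w ≡ mate N w

  ForcesOn : PerfectMatching G → List (Fin (n G)) → Pred (Fin (n G)) 0ℓ → Set
  ForcesOn M R X = ∀ N → ContainedIn M R N → AgreeOn X N M

  module Patch {X : Pred (Fin (n G)) 0ℓ} (X? : Decidable X) (A B : PerfectMatching G)
               (A-closed : Closed A X) (B-closed : Closed B X) where

    patchMate : Fin (n G) → Fin (n G)
    patchMate w with X? w
    ... | yes _ = mate A w
    ... | no  _ = mate B w

    patchMate-in : ∀ {w} → X w → patchMate w ≡ mate A w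
    patchMate-in {w} x with X? w
    ... | yes _  = refl
    ... | no  ¬x = ⊥-elim (¬x x)

    patchMate-out : ∀ {w} → ¬ X w → patchMate w ≡ mate B w
    patchMate-out {w} ¬x with X? w
    ... | yes x = ⊥-elim (¬x x)
    ... | no  _ = refl

    patchMate-involutive : ∀ w → patchMate (patchMate w) ≡ w
    patchMate-involutive w with X? w
    ... | yes x  = trans (patchMate-in (A-closed x)) (involutive A w)
    ... | no  ¬x = trans (patchMate-out (¬x ∘ from-mate)) (involutive B w)
      where
      from-mate : X (mate B w) → X w
      from-mate x = subst X (involutive B w) (B-closed x)

    patchMate-isEdge : ∀ w → Edge G w (patchMate w)
    patchMate-isEdge w with X? w
    ... | yes _ = isEdge A w
    ... | no  _ = isEdge B w

    patch : PerfectMatching G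
    patch = record { mate = patchMate ; involutive = patchMate-involutive ; isEdge = patchMate-isEdge }

  module _ {X : Pred (Fin (n G)) 0ℓ} (X? : Decidable X) {M M' : PerfectMatching G}
           (M-closed : Closed M X) (M'-closed : Closed M' X) (agree-off : AgreeOn (∁ X) M M') where

    -- N ⊇ R ∪ (S ∖ X) agrees with M on X; patching M' into N on X gives a matching
    -- containing S, which is therefore M', so N agrees with M off X as well.
    forcingSet-transfer : ∀ {R S} → ForcesOn M R X
      → IsForcingSet M' S → IsForcingSet M (R ++ filter (∁? X?) S)
    forcingSet-transfer {R} {S} R-forces S-forcing N N⊇R∪S∖X = N≡M
      where
      N⊇R    = proj₁ (++⁻ R N⊇R∪S∖X)
      N⊇S∖X = proj₂ (++⁻ R N⊇R∪S∖X)

      N-agree : AgreeOn X N M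
      N-agree = R-forces N N⊇R

      N-closed : Closed N X
      N-closed x = subst X (≡.sym (N-agree x)) (M-closed x)

      open Patch X? M' N M'-closed N-closed

      patch⊇S : ContainedIn M' S patch
      patch⊇S = All.tabulate patch-on-S
        where
        patch-on-S : ∀ {w} → w ∈ S → patchMate w ≡ mate M' w
        patch-on-S {w} w∈S = by-cases (X? w)
          where
          by-cases : Dec (X w) → patchMate w ≡ mate M' w
          by-cases (yes x)  = patchMate-in x
          by-cases (no  ¬x) = trans (patchMate-out ¬x)
            (trans (All.lookup N⊇S∖X (∈-filter⁺ (∁? X?) w∈S ¬x)) (agree-off ¬x))

      N≡M : SameMatching N M
      N≡M w with X? w
      ... | yes x  = N-agree x
      ... | no  ¬x = trans (≡.sym (patchMate-out ¬x))
                       (trans (S-forcing patch patch⊇S w) (≡.sym (agree-off ¬x)))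

    forcingSet-meets : ¬ SameMatching M M' → ∀ {S} → IsForcingSet M' S → Any X S
    forcingSet-meets M≢M' {S} S-forcing with any? X? S
    ... | yes meets = meets
    ... | no  ¬meets = ⊥-elim (M≢M' (S-forcing M M⊇S))
      where
      M⊇S : ContainedIn M' S M
      M⊇S = All.map agree-off (¬Any⇒All¬ S ¬meets)

    forcingNumber-transfer : ∀ {R a b} → ForcesOn M R X
      → ¬ SameMatching M M' → IsForcingNumber G M a → IsForcingNumber G M' b
      → a < length R + b
    forcingNumber-transfer {R} {a} {b} R-forces M≢M' (_ , a-minimal) ((S , S-forcing , refl) , _) =
      begin-strict
        a                                     ≤⟨ a-minimal _ (forcingSet-transfer R-forces S-forcing) ⟩
        length (R ++ filter (∁? X?) S)        ≡⟨ length-++ R ⟩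
        length R + length (filter (∁? X?) S) <⟨ +-monoʳ-< (length R) S∖X-shorter ⟩
        length R + length S                   ∎
      where
      open ≤-Reasoning
      S∖X-shorter : length (filter (∁? X?) S) < length S
      S∖X-shorter = filter-notAll (∁? X?) S (Any.map (λ x ¬x → ¬x x) (forcingSet-meets M≢M' S-forcing))

TwoSwitch-sym : {G : Graph} {M M' : PerfectMatching G} → TwoSwitch M M' → TwoSwitch M' M
TwoSwitch-sym {G} {M} (u₁ , v₁ , u₂ , v₂ , M-u₁ , M-u₂ , _ , u₂≢v₁ , _ , _ , M'-u₁ , M'-v₁ , rest) =
  u₁ , u₂ , v₁ , v₂ , M'-u₁ , M'-v₁
  , (λ v₁≡u₁ → edge-irrefl {G} (isEdge M u₁) (trans (≡.sym v₁≡u₁) (≡.sym M-u₁)))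
  , (λ v₁≡u₂ → u₂≢v₁ (≡.sym v₁≡u₂))
  , subst (Edge G u₁) M-u₁ (isEdge M u₁) , subst (Edge G u₂) M-u₂ (isEdge M u₂)
  , M-u₁ , M-u₂ , (λ w w≢u₁ w≢u₂ w≢v₁ w≢v₂ → ≡.sym (rest w w≢u₁ w≢v₁ w≢u₂ w≢v₂))

module SwitchedQuad {G : Graph} {M M' : PerfectMatching G} {u₁ v₁ u₂ v₂ : Fin (n G)}
  (M-u₁ : mate M u₁ ≡ v₁) (M-u₂ : mate M u₂ ≡ v₂) (u₂≢v₁ : ¬ u₂ ≡ v₁)
  (M'-u₁ : mate M' u₁ ≡ u₂) (M'-v₁ : mate M' v₁ ≡ v₂)
  (rest : ∀ w → ¬ w ≡ u₁ → ¬ w ≡ v₁ → ¬ w ≡ u₂ → ¬ w ≡ v₂ → mate M' w ≡ mate M w) where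

  quad : List (Fin (n G))
  quad = u₁ ∷ v₁ ∷ u₂ ∷ v₂ ∷ []

  open import Data.List.Membership.DecPropositional (_≟_ {n G}) using (_∈?_)

  _∈quad? : Decidable (_∈ quad)
  w ∈quad? = w ∈? quad

  M-closed : Closed M (_∈ quad)
  M-closed (here refl)                         = there (here M-u₁)
  M-closed (there (here refl))                 = here (mate-inverse M M-u₁)
  M-closed (there (there (here refl)))         = there (there (there (here M-u₂)))
  M-closed (there (there (there (here refl)))) = there (there (here (mate-inverse M M-u₂)))

  M'-closed : Closed M' (_∈ quad)
  M'-closed (here refl)                         = there (there (here M'-u₁))
  M'-closed (there (here refl))                 = there (there (there (here M'-v₁)))
  M'-closed (there (there (here refl)))         = here (mate-inverse M' M'-u₁)
  M'-closed (there (there (there (here refl)))) = there (here (mate-inverse M' M'-v₁))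

  agree-off : AgreeOn (∁ (_∈ quad)) M M'
  agree-off {w} w∉quad =
    ≡.sym (rest w (w∉quad ∘ here) (w∉quad ∘ there ∘ here)
                (w∉quad ∘ there ∘ there ∘ here) (w∉quad ∘ there ∘ there ∘ there ∘ here))

  forces-quad : ForcesOn M (u₁ ∷ u₂ ∷ []) (_∈ quad)
  forces-quad N (N-u₁ ∷ N-u₂ ∷ []) (here refl)                 = N-u₁
  forces-quad N (N-u₁ ∷ N-u₂ ∷ []) (there (here refl))         =
    subst (λ x → mate N x ≡ mate M x) M-u₁ (agree-at-mate N M N-u₁)
  forces-quad N (N-u₁ ∷ N-u₂ ∷ []) (there (there (here refl))) = N-u₂
  forces-quad N (N-u₁ ∷ N-u₂ ∷ []) (there (there (there (here refl)))) =
    subst (λ x → mate N x ≡ mate M x) M-u₂ (agree-at-mate N M N-u₂)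

  M≢M' : ¬ SameMatching M M'
  M≢M' same = u₂≢v₁ (trans (≡.sym M'-u₁) (trans (≡.sym (same u₁)) M-u₁))

forcingNumber-TwoSwitch : {G : Graph} {M M' : PerfectMatching G} {a b : ℕ} → TwoSwitch M M'
  → IsForcingNumber G M a → IsForcingNumber G M' b → a ≤ suc b
forcingNumber-TwoSwitch {G} {M} {M'} (_ , _ , _ , _ , M-u₁ , M-u₂ , _ , u₂≢v₁ , _ , _ , M'-u₁ , M'-v₁ , rest) fM fM' =
  s≤s⁻¹ (forcingNumber-transfer _∈quad? {M} {M'} M-closed M'-closed agree-off forces-quad M≢M' fM fM')
  where open SwitchedQuad {G} {M} {M'} M-u₁ M-u₂ u₂≢v₁ M'-u₁ M'-v₁ rest

intermediateValue-up : ∀ t (f : Fin (suc t) → ℕ) → (∀ i → f (Fin.suc i) ≤ suc (f (inject₁ i)))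
  → ∀ {k} → f zero ≤ k → k ≤ f (fromℕ t) → ∃[ i ] f i ≡ k
intermediateValue-up zero    f steps f₀≤k k≤fₜ = zero , ≤-antisym f₀≤k k≤fₜ
intermediateValue-up (suc t) f steps {k} f₀≤k k≤fₜ with k ≤? f (inject₁ (fromℕ t))
... | yes k≤fₜ₋₁ with intermediateValue-up t (f ∘ inject₁) (steps ∘ inject₁) f₀≤k k≤fₜ₋₁
...   | i , fi≡k = inject₁ i , fi≡k
intermediateValue-up (suc t) f steps {k} f₀≤k k≤fₜ | no k≰fₜ₋₁ =
  fromℕ (suc t) , ≤-antisym (≤-trans (steps (fromℕ t)) (≰⇒> k≰fₜ₋₁)) k≤fₜ

intermediateValue-down : ∀ t (f : Fin (suc t) → ℕ) → (∀ i → f (inject₁ i) ≤ suc (f (Fin.suc i)))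
  → ∀ {k} → f (fromℕ t) ≤ k → k ≤ f zero → ∃[ i ] f i ≡ k
intermediateValue-down zero    f steps fₜ≤k k≤f₀ = zero , ≤-antisym fₜ≤k k≤f₀
intermediateValue-down (suc t) f steps {k} fₜ≤k k≤f₀ with f (inject₁ (fromℕ t)) ≤? k
... | yes fₜ₋₁≤k with intermediateValue-down t (f ∘ inject₁) (steps ∘ inject₁) fₜ₋₁≤k k≤f₀
...   | i , fi≡k = inject₁ i , fi≡k
intermediateValue-down (suc t) f steps {k} fₜ≤k k≤f₀ | no fₜ₋₁≰k =
  fromℕ (suc t) , ≤-antisym fₜ≤k (s≤s⁻¹ (≤-trans (≰⇒> fₜ₋₁≰k) (steps (fromℕ t))))

mainTheorem5 : (G : Graph) (t : ℕ) (M : Fin (suc t) → PerfectMatching G)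
    → (∀ (i : Fin t) → TwoSwitch (M (inject₁ i)) (M (Fin.suc i)))
    → (f : Fin (suc t) → ℕ) → (∀ i → IsForcingNumber G (M i) (f i))
    → ∀ (k : ℕ) → ((f zero ≤ k × k ≤ f (fromℕ t)) ⊎ (f (fromℕ t) ≤ k × k ≤ f zero))
    → ∃[ i ] f i ≡ k
mainTheorem5 G t M switch f forcing k (inj₁ (f₀≤k , k≤fₜ)) = intermediateValue-up t f step-up f₀≤k k≤fₜ
  where
  step-up : ∀ i → f (Fin.suc i) ≤ suc (f (inject₁ i))
  step-up i = forcingNumber-TwoSwitch {M = M (Fin.suc i)} {M (inject₁ i)}
    (TwoSwitch-sym {M = M (inject₁ i)} {M (Fin.suc i)} (switch i)) (forcing (Fin.suc i)) (forcing (inject₁ i))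
mainTheorem5 G t M switch f forcing k (inj₂ (fₜ≤k , k≤f₀)) = intermediateValue-down t f step-down fₜ≤k k≤f₀
  where
  step-down : ∀ i → f (inject₁ i) ≤ suc (f (Fin.suc i))
  step-down i = forcingNumber-TwoSwitch {M = M (inject₁ i)} {M (Fin.suc i)}
    (switch i) (forcing (inject₁ i)) (forcing (Fin.suc i))
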